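{- Let $k\ge r\ge3$, $t\ge0$, and let $\pi\in\mathbb{C}(k,r)$ have largest odd part $2t+1$. Then: (1) if there is a $2$-marked part $2t+2$ in $GG(\pi)$, it is of starting type $s_0$ or $s_2$; (2) if there is a $2$-marked part $2t+4$ in $GG(\pi)$, it is of starting type $s_3$.
   Context: A partition is a finite non-increasing sequence of positive integers. $\mathbb{C}(k,r)$ is the set of partitions $\pi=(\pi_1,\dots,\pi_\ell)$ with no repeated odd part, $\pi_i\ge\pi_{i+k-1}+2$ for $1\le i\le\ell-k+1$ (strict if $\pi_i$ even), and at most $r-1$ parts $\le2$. Göllnitz–Gordon marking $GG(\pi)$: marks (positive integers) are assigned to the parts from smallest to largest, each as small as possible subject to: the mark of $\pi_i$ differs from the marks of all parts $\pi_g$, $g>i$, with $\pi_i-\pi_g\le2$ (strict if $\pi_i$ odd). A "$j$-marked $x$" is a part $x$ with mark $j$. $N_j$ is the number of $j$-marked parts and $\pi^{(j)}_1>\cdots>\pi^{(j)}_{N_j}$ are these parts; $\pi^{(j)}_0=+\infty$. Starting types (for $N_2\ge1$): let $l$ be the largest integer $0\le l\le N_2$ such that no odd part of $\pi$ is $\ge\pi^{(2)}_l$; parts $\pi^{(2)}_i$, $i>l$, are of type $s_{ -1}$. For $b=1$: $\pi^{(2)}_1$ is of type $s_0$ [resp. $s_1$] with $s_1(\pi)=\pi^{(2)}_1-1$ [resp. $-2$] if there is a 1-marked $\pi^{(2)}_1-1$ [resp. $\pi^{(2)}_1-2$] and $\pi^{(2)}_1+2$ does not occur; of type $s_2$ ($s_1(\pi)=\pi^{(2)}_1+2$)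 if there is a 1-marked $\pi^{(2)}_1+2$; of type $s_3$ ($s_1(\pi)=\pi^{(2)}_1$) if there is a 1-marked $\pi^{(2)}_1$. For $b=2,\dots,l$: type $s_0$ [resp. $s_1$], $s_b(\pi)=\pi^{(2)}_b-1$ [resp. $-2$], if there is a 1-marked $\pi^{(2)}_b-1$ [resp. $-2$] and, whenever a 1-marked $\pi^{(2)}_b+2$ exists, $s_{b-1}(\pi)=\pi^{(2)}_b+2$; type $s_2$ ($s_b(\pi)=\pi^{(2)}_b+2$) if there is a 1-marked $\pi^{(2)}_b+2$ and $s_{b-1}(\pi)\neq\pi^{(2)}_b+2$; type $s_3$ ($s_b(\pi)=\pi^{(2)}_b$) if there is a 1-marked $\pi^{(2)}_b$. -}

module Defs where

open import Data.Nat using (ℕ; zero; suc; _+_; _∸_; _≤_; _<_; _%_; _≡ᵇ_; _<ᵇ_; _≤ᵇ_)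
open import Data.Nat.Properties using (_≟_)
open import Data.Bool using (Bool; true; false; if_then_else_; not; _∨_)
open import Data.List using (List; []; _∷_; _++_; [_]; length; filter; map; reverse; filterᵇ)
open import Data.Bool.ListAction using (all; any)
open import Data.List.Membership.Propositional using (_∈_)
open import Data.List.Relation.Unary.All using (All)
open import Data.List.Relation.Unary.Linked using (Linked)
open import Data.Product using (_×_; _,_; proj₁; proj₂)
open import Data.Sum using (_⊎_)
open import Data.Empty using (⊥)
open import Relation.Nullary using (¬_)
open import Relation.Binary.PropositionalEquality using (_≡_)

Odd : ℕ → Set
Odd n = n % 2 ≡ 1

Even : ℕ → Set
Even n = n % 2 ≡ 0

oddᵇ : ℕ → Bool
oddᵇ n = (n % 2) ≡ᵇ 1

-- Partitions are lists π = (π₁ , … , π_ℓ) (π₁ is the head, largest part).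

-- 1-based access to parts; out-of-range indices give 0 (never used in range).
part : List ℕ → ℕ → ℕ
part []       _             = 0
part (x ∷ xs) zero          = 0
part (x ∷ xs) (suc zero)    = x
part (x ∷ xs) (suc (suc i)) = part xs (suc i)

IsPartition : List ℕ → Set
IsPartition π = All (λ x → 1 ≤ x) π × Linked (λ a b → b ≤ a) π

InC : ℕ → ℕ → List ℕ → Set
InC k r π =
  IsPartition π
  × (∀ i j → 1 ≤ i → i < j → j ≤ length π → part π i ≡ part π j → ¬ Odd (part π i))
  × (∀ i → 1 ≤ i → i + (k ∸ 1) ≤ length π →
       (Even (part π i) → part π (i + (k ∸ 1)) + 2 < part π i)
     × (Odd (part π i) → part π (i + (k ∸ 1)) + 2 ≤ part π i))
  × length (filterᵇ (λ x → x ≤ᵇ 2) π) ≤ r ∸ 1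

_∈ᵇ_ : ℕ → List ℕ → Bool
n ∈ᵇ ms = any (λ m → n ≡ᵇ m) ms

-- smallest integer ≥ c not in ms (fuel large enough when fuel > length ms)
firstFree : ℕ → ℕ → List ℕ → ℕ
firstFree zero     c ms = c
firstFree (suc f) c ms = if c ∈ᵇ ms then firstFree f (suc c) ms else c

mex : List ℕ → ℕ
mex ms = firstFree (suc (length ms)) 1 ms

-- does an (earlier processed, hence smaller or equal) part y conflict with x?
-- condition: x - y ≤ 2, strict if x is odd
conflictᵇ : ℕ → ℕ → Bool
conflictᵇ x y = if oddᵇ x then (x ∸ y) <ᵇ 2 else (x ∸ y) ≤ᵇ 2

markGo : List (ℕ × ℕ) → List ℕ → List (ℕ × ℕ)
markGo acc []       = acc
markGo acc (x ∷ xs) =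
  markGo (acc ++ [ (x , mex (map proj₂ (filterᵇ (λ p → conflictᵇ x (proj₁ p)) acc))) ]) xs

GG : List ℕ → List (ℕ × ℕ)
GG π = markGo [] (reverse π)

Marked : List ℕ → ℕ → ℕ → Set
Marked π j x = (x , j) ∈ GG π

-- the j-marked parts π^(j)_1 > π^(j)_2 > … (decreasing)
markedParts : List ℕ → ℕ → List ℕ
markedParts π j = reverse (map proj₁ (filterᵇ (λ p → proj₂ p ≡ᵇ j) (GG π)))

N : List ℕ → ℕ → ℕ
N π j = length (markedParts π j)

p2 : List ℕ → ℕ → ℕ
p2 π b = part (markedParts π 2) b

-- "no odd part of π is ≥ π^(2)_l" (π^(2)_0 = +∞, so always true for l = 0)
noOddAboveᵇ : List ℕ → ℕ → Bool
noOddAboveᵇ π zero    = true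
noOddAboveᵇ π (suc l) = all (λ q → not (oddᵇ q) ∨ (q <ᵇ p2 π (suc l))) π

largestFrom : List ℕ → ℕ → ℕ
largestFrom π zero    = zero
largestFrom π (suc n) = if noOddAboveᵇ π (suc n) then suc n else largestFrom π n

lval : List ℕ → ℕ
lval π = largestFrom π (N π 2)

InRange : List ℕ → ℕ → Set
InRange π b = 1 ≤ b × b ≤ lval π

Occurs : List ℕ → ℕ → Set
Occurs π x = x ∈ π

mutual
  TypeS0 : List ℕ → ℕ → Set
  TypeS0 π zero = ⊥
  TypeS0 π (suc zero) =
    InRange π 1 × Marked π 1 (p2 π 1 ∸ 1) × ¬ Occurs π (p2 π 1 + 2)
  TypeS0 π (suc (suc b)) =
    InRange π (suc (suc b)) × Marked π 1 (p2 π (suc (suc b)) ∸ 1)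
    × (Marked π 1 (p2 π (suc (suc b)) + 2) → SVal π (suc b) (p2 π (suc (suc b)) + 2))

  TypeS1 : List ℕ → ℕ → Set
  TypeS1 π zero = ⊥
  TypeS1 π (suc zero) =
    InRange π 1 × Marked π 1 (p2 π 1 ∸ 2) × ¬ Occurs π (p2 π 1 + 2)
  TypeS1 π (suc (suc b)) =
    InRange π (suc (suc b)) × Marked π 1 (p2 π (suc (suc b)) ∸ 2)
    × (Marked π 1 (p2 π (suc (suc b)) + 2) → SVal π (suc b) (p2 π (suc (suc b)) + 2))

  TypeS2 : List ℕ → ℕ → Set
  TypeS2 π zero = ⊥
  TypeS2 π (suc zero) = InRange π 1 × Marked π 1 (p2 π 1 + 2)
  TypeS2 π (suc (suc b)) =
    InRange π (suc (suc b)) × Marked π 1 (p2 π (suc (suc b)) + 2)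
    × ¬ SVal π (suc b) (p2 π (suc (suc b)) + 2)

  TypeS3 : List ℕ → ℕ → Set
  TypeS3 π zero = ⊥
  TypeS3 π (suc b) = InRange π (suc b) × Marked π 1 (p2 π (suc b))

  SVal : List ℕ → ℕ → ℕ → Set
  SVal π b v =
    (TypeS0 π b × v ≡ p2 π b ∸ 1)
    ⊎ (TypeS1 π b × v ≡ p2 π b ∸ 2)
    ⊎ (TypeS2 π b × v ≡ p2 π b + 2)
    ⊎ (TypeS3 π b × v ≡ p2 π b)

LargestOdd : List ℕ → ℕ → Set
LargestOdd π o = o ∈ π × Odd o × All (λ x → Odd x → x ≤ o) π

-- Parts are marked from the smallest upwards, and a part x gets the least mark not used
-- by a conflicting smaller part already marked.  Let o = 2t+1 be the largest odd part.
-- When o is marked, mark 1 is used by o or o-1 unless o gets 1, and mark 2 likewise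
-- unless o gets 1 or 2.  Both o and o-1 conflict with o+1, so o+1 is never 1-marked and
-- is 2-marked only if o = (o+1)-1 is 1-marked, which gives type s0 or s2.  Below o+3 the
-- only conflicting parts are o+1 (never 1-marked) and o+2 (odd and larger than o, hence
-- absent), so o+3 is 1-marked as soon as it occurs, which gives type s3.
module Submission where

open import Defs
open import Data.Nat using (ℕ; zero; suc; _+_; _*_; _∸_; _≤_; _<_; _≡ᵇ_; _<ᵇ_; z≤n; s≤s; s≤s⁻¹)
open import Data.Nat.Properties
open import Data.Bool using (true; false; T; not; _∨_)
open import Data.Bool.ListAction using (all)
open import Data.Unit using (tt)
open import Data.Empty using (⊥-elim)
open import Data.Product using (_×_; _,_; proj₁; proj₂; ∃-syntax)
open import Data.Product.Properties using (≡-dec)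
open import Data.Sum using (_⊎_; inj₁; inj₂)
open import Data.List using (List; []; _∷_; _++_; length; map; filterᵇ; reverse)
open import Data.List.Properties using (unfold-reverse)
open import Data.List.Membership.Propositional using (_∈_; _∉_)
open import Data.List.Membership.Propositional.Properties
  using (∈-++⁺ˡ; ∈-++⁺ʳ; ∈-++⁻; ∈-map⁻; ∈-filter⁻; ∈-map∘filter⁺; ∈-map∘filter⁻)
import Data.List.Membership.DecPropositional as DecMembership
open import Data.List.Relation.Unary.Any as Any using (here; there)
open import Data.List.Relation.Unary.Any.Properties using (any⁺; any⁻; reverse⁺; reverse⁻)
open import Data.List.Relation.Unary.All as All using (All; []; _∷_)
open import Data.List.Relation.Unary.All.Properties using (all⁻; ++⁻)
open import Data.List.Relation.Unary.AllPairs using (AllPairs; []; _∷_)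
import Data.List.Relation.Unary.AllPairs.Properties as AllPairs
open import Data.List.Relation.Unary.Linked using (Linked)
open import Data.List.Relation.Unary.Linked.Properties using (Linked⇒AllPairs)
open import Function using (_∘_; flip)
open import Relation.Nullary using (Dec; yes; no)
open import Relation.Nullary.Decidable using (T?; _×-dec_; _⊎-dec_; _→-dec_; ¬?)
open import Relation.Nullary.Reflects using (Reflects; ofʸ; ofⁿ; fromEquivalence)
open import Relation.Binary.PropositionalEquality using (_≡_; _≢_; refl; sym; trans; cong; subst)

between-suc : ∀ {m k} → m ≤ k → k ≤ suc m → k ≡ m ⊎ k ≡ suc m
between-suc m≤k k≤1+m with m≤n⇒m<n∨m≡n k≤1+m
... | inj₁ k<1+m = inj₁ (≤-antisym (s≤s⁻¹ k<1+m) m≤k)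
... | inj₂ k≡1+m = inj₂ k≡1+m

m∸n≤o⇒m≤o+n : ∀ m n {o} → m ∸ n ≤ o → m ≤ o + n
m∸n≤o⇒m≤o+n m n {o} m∸n≤o =
  ≤-trans (m≤n+m∸n m n) (≤-trans (+-monoʳ-≤ n m∸n≤o) (≤-reflexive (+-comm n o)))

odd⇒suc-even : ∀ m → oddᵇ m ≡ true → oddᵇ (suc m) ≡ false
odd⇒suc-even zero          ()
odd⇒suc-even (suc zero)    _   = refl
odd⇒suc-even (suc (suc m)) odd = odd⇒suc-even m odd

conflict⇒≤2+ : ∀ x y → T (conflictᵇ x y) → x ≤ 2 + y
conflict⇒≤2+ x y c with oddᵇ x
... | true  = m∸n≤o⇒m≤o+n x y (<⇒≤ (<ᵇ⇒< _ 2 c))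
... | false = m∸n≤o⇒m≤o+n x y (≤ᵇ⇒≤ _ 2 c)

odd-conflict⇒≤1+ : ∀ x y → oddᵇ x ≡ true → T (conflictᵇ x y) → x ≤ 1 + y
odd-conflict⇒≤1+ x y odd c with oddᵇ x
odd-conflict⇒≤1+ x y _  c | true = m∸n≤o⇒m≤o+n x y (s≤s⁻¹ (<ᵇ⇒< _ 2 c))
odd-conflict⇒≤1+ x y () c | false

even-conflict : ∀ x y → oddᵇ x ≡ false → x ≤ 2 + y → T (conflictᵇ x y)
even-conflict x y even x≤2+y with oddᵇ x
even-conflict x y () _      | true
even-conflict x y _  x≤2+y  | false =
  ≤⇒≤ᵇ (m≤n+o⇒m∸n≤o x y (subst (x ≤_) (+-comm 2 y) x≤2+y))

∈ᵇ-reflects : ∀ n ms → Reflects (n ∈ ms) (n ∈ᵇ ms)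
∈ᵇ-reflects n ms = fromEquivalence
  (λ h → Any.map (≡ᵇ⇒≡ n _) (any⁻ _ ms h))
  (λ n∈ms → any⁺ _ (Any.map (≡⇒≡ᵇ n _) n∈ms))

firstFree-≥ : ∀ f c ms → c ≤ firstFree f c ms
firstFree-≥ zero    c ms = ≤-refl
firstFree-≥ (suc f) c ms with c ∈ᵇ ms
... | true  = ≤-trans (n≤1+n c) (firstFree-≥ f (suc c) ms)
... | false = ≤-refl

firstFree-≤ : ∀ f {c j} ms → c ≤ j → j ∉ ms → firstFree f c ms ≤ j
firstFree-≤ zero        ms c≤j _ = c≤j
firstFree-≤ (suc f) {c} ms c≤j j∉ms with c ∈ᵇ ms | ∈ᵇ-reflects c ms
... | true  | ofʸ c∈ms =
  firstFree-≤ f ms (≤∧≢⇒< c≤j (λ c≡j → j∉ms (subst (_∈ ms) c≡j c∈ms))) j∉ms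
... | false | ofⁿ _ = c≤j

firstFree-≢ : ∀ f {c j} ms → j ∈ ms → j < c + f → firstFree f c ms ≢ j
firstFree-≢ zero    {c} ms _    j<c+0 = >⇒≢ (subst (_ <_) (+-identityʳ c) j<c+0)
firstFree-≢ (suc f) {c} {j} ms j∈ms j<c+1+f with c ∈ᵇ ms | ∈ᵇ-reflects c ms
... | true  | ofʸ _    = firstFree-≢ f {suc c} ms j∈ms (subst (j <_) (+-suc c f) j<c+1+f)
... | false | ofⁿ c∉ms = λ c≡j → c∉ms (subst (_∈ ms) (sym c≡j) j∈ms)

mex-positive : ∀ ms → 1 ≤ mex ms
mex-positive ms = firstFree-≥ (suc (length ms)) 1 ms

mex-≤ : ∀ {j} ms → 1 ≤ j → j ∉ ms → mex ms ≤ j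
mex-≤ ms = firstFree-≤ (suc (length ms)) ms

-- For j ≤ 2 the fuel suc (length ms) of mex visibly suffices to step past j.
mex-≢ : ∀ {j} ms → j ∈ ms → j ≤ 2 → mex ms ≢ j
mex-≢ ms@(_ ∷ ms′) j∈ms j≤2 =
  firstFree-≢ (suc (length ms)) {1} ms j∈ms (s≤s (≤-trans j≤2 (m≤m+n 2 (length ms′))))

conflictingMarks : ℕ → List (ℕ × ℕ) → List ℕ
conflictingMarks x acc = map proj₂ (filterᵇ (λ p → conflictᵇ x (proj₁ p)) acc)

conflictingMarks⁺ : ∀ {x y j acc} → (y , j) ∈ acc → T (conflictᵇ x y) → j ∈ conflictingMarks x acc
conflictingMarks⁺ {x} p c = ∈-map∘filter⁺ proj₂ (T? ∘ λ p → conflictᵇ x (proj₁ p)) (_ , p , refl , c)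

conflictingMarks⁻ : ∀ {x j acc} → j ∈ conflictingMarks x acc → ∃[ y ] (y , j) ∈ acc × T (conflictᵇ x y)
conflictingMarks⁻ {x} q with ∈-map∘filter⁻ proj₂ (T? ∘ λ p → conflictᵇ x (proj₁ p)) q
... | (y , _) , p , refl , c = y , p , c

markGo-++ : ∀ acc xs ys → markGo acc (xs ++ ys) ≡ markGo (markGo acc xs) ys
markGo-++ acc []       ys = refl
markGo-++ acc (x ∷ xs) ys = markGo-++ _ xs ys

markGo-⊇ : ∀ {e} acc xs → e ∈ acc → e ∈ markGo acc xs
markGo-⊇ acc []       p = p
markGo-⊇ acc (x ∷ xs) p = markGo-⊇ _ xs (∈-++⁺ˡ p)

markGo-total : ∀ acc {y} xs → y ∈ xs → ∃[ m ] (y , m) ∈ markGo acc xs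
markGo-total acc (x ∷ xs) (here refl)  = _ , markGo-⊇ _ xs (∈-++⁺ʳ acc (here refl))
markGo-total acc (x ∷ xs) (there y∈xs) = markGo-total _ xs y∈xs

record Entry (acc : List (ℕ × ℕ)) (zs : List ℕ) (y m : ℕ) : Set where
  field
    before after : List ℕ
    split        : zs ≡ before ++ y ∷ after
    mark≡        : m ≡ mex (conflictingMarks y (markGo acc before))

open Entry

markGo-entry : ∀ acc zs {y m} → (y , m) ∈ markGo acc zs → (y , m) ∈ acc ⊎ Entry acc zs y m
markGo-entry acc []       p = inj₁ p
markGo-entry acc (x ∷ zs) p with markGo-entry _ zs p
... | inj₂ E = inj₂ record
  { before = x ∷ before E ; after = after E ; split = cong (x ∷_) (split E) ; mark≡ = mark≡ E }
... | inj₁ p′ with ∈-++⁻ acc p′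
...   | inj₁ p″         = inj₁ p″
...   | inj₂ (here refl) = inj₂ record { before = [] ; after = zs ; split = refl ; mark≡ = refl }

entry : ∀ {zs y m} → (y , m) ∈ markGo [] zs → Entry [] zs y m
entry {zs} p with markGo-entry [] zs p
... | inj₁ ()
... | inj₂ E = E

entry-⊆ : ∀ {acc zs y m e} (E : Entry acc zs y m) → e ∈ markGo acc (before E) → e ∈ markGo acc zs
entry-⊆ {acc} {y = y} {e = e} E p =
  subst (λ ws → e ∈ markGo acc ws) (sym (split E))
    (subst (e ∈_) (sym (markGo-++ acc (before E) (y ∷ after E))) (markGo-⊇ _ (y ∷ after E) p))

markGo-parts : ∀ {zs y m} → (y , m) ∈ markGo [] zs → y ∈ zs
markGo-parts {zs} p with entry {zs} p
... | E = subst (_ ∈_) (sym (split E)) (∈-++⁺ʳ (before E) (here refl))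

mark-positive : ∀ {zs y m} → (y , m) ∈ markGo [] zs → 1 ≤ m
mark-positive {zs} {y} p with E ← entry {zs} p =
  subst (1 ≤_) (sym (mark≡ E)) (mex-positive (conflictingMarks y (markGo [] (before E))))

AllPairs-reverse : ∀ {A : Set} {R : A → A → Set} {xs} → AllPairs (flip R) xs → AllPairs R (reverse xs)
AllPairs-reverse {xs = []}     []       = []
AllPairs-reverse {xs = x ∷ xs} (px ∷ r) =
  subst (AllPairs _) (sym (unfold-reverse x xs))
    (AllPairs.++⁺ (AllPairs-reverse r) ([] ∷ [])
      (All.tabulate (λ y∈ → All.lookup px (reverse⁻ y∈) ∷ [])))

AllPairs-split : ∀ {A : Set} {R : A → A → Set} as {y bs} → AllPairs R (as ++ y ∷ bs)
               → AllPairs R as × All (λ a → R a y) as × All (R y) bs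
AllPairs-split []       (py ∷ _)    = [] , [] , py
AllPairs-split (a ∷ as) (pa ∷ rest) with AllPairs-split as rest | ++⁻ as pa
... | Ras , as-y , y-bs | a-as , a-y ∷ _ = (a-as ∷ Ras) , (a-y ∷ as-y) , y-bs

module _ {zs y m} (asc : AllPairs _≤_ zs) (E : Entry [] zs y m) where

  private
    split-asc : AllPairs _≤_ (before E) × All (_≤ y) (before E) × All (y ≤_) (after E)
    split-asc = AllPairs-split (before E) (subst (AllPairs _≤_) (split E) asc)

  before-ascending : AllPairs _≤_ (before E)
  before-ascending = proj₁ split-asc

  before-≤ : ∀ {x} → x ∈ before E → x ≤ y
  before-≤ = All.lookup (proj₁ (proj₂ split-asc))

  smaller-before : ∀ {x} → x ∈ zs → x < y → x ∈ before E
  smaller-before x∈zs x<y with ∈-++⁻ (before E) (subst (_ ∈_) (split E) x∈zs)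
  ... | inj₁ x∈ = x∈
  ... | inj₂ (here refl) = ⊥-elim (<-irrefl refl x<y)
  ... | inj₂ (there x∈) = ⊥-elim (<⇒≱ x<y (All.lookup (proj₂ (proj₂ split-asc)) x∈))

mark≤-or-taken : ∀ {zs x m j} → AllPairs _≤_ zs → (x , m) ∈ markGo [] zs → 1 ≤ j
               → m ≤ j ⊎ ∃[ y ] (y , j) ∈ markGo [] zs × y ≤ x × T (conflictᵇ x y)
mark≤-or-taken {zs} {x} {j = j} asc p 1≤j
  with E ← entry {zs} p
  with DecMembership._∈?_ _≟_ j (conflictingMarks x (markGo [] (before E)))
... | no j∉  = inj₁ (subst (_≤ j) (sym (mark≡ E)) (mex-≤ _ 1≤j j∉))
... | yes j∈ with conflictingMarks⁻ {acc = markGo [] (before E)} j∈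
...   | y , q , c = inj₂ (y , entry-⊆ E q , before-≤ asc E (markGo-parts {before E} q) , c)

mark≤1⇒1-marked : ∀ {zs y m} → (y , m) ∈ markGo [] zs → m ≤ 1 → (y , 1) ∈ markGo [] zs
mark≤1⇒1-marked {zs} p m≤1 = subst (λ i → (_ , i) ∈ _) (≤-antisym m≤1 (mark-positive {zs} p)) p

odd-mark≤-or-taken : ∀ {zs n m j} → AllPairs _≤_ zs → oddᵇ (suc n) ≡ true
                   → (suc n , m) ∈ markGo [] zs → 1 ≤ j
                   → m ≤ j ⊎ (suc n , j) ∈ markGo [] zs ⊎ (n , j) ∈ markGo [] zs
odd-mark≤-or-taken asc odd p 1≤j with mark≤-or-taken asc p 1≤j
... | inj₁ m≤j = inj₁ m≤j
... | inj₂ (y , q , y≤1+n , c) with between-suc (s≤s⁻¹ (odd-conflict⇒≤1+ _ y odd c)) y≤1+n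
...   | inj₁ refl = inj₂ (inj₂ q)
...   | inj₂ refl = inj₂ (inj₁ q)

odd-or-pred-1-marked : ∀ {zs n m} → AllPairs _≤_ zs → oddᵇ (suc n) ≡ true
                     → (suc n , m) ∈ markGo [] zs
                     → (suc n , 1) ∈ markGo [] zs ⊎ (n , 1) ∈ markGo [] zs
odd-or-pred-1-marked {zs} asc odd p with odd-mark≤-or-taken asc odd p ≤-refl
... | inj₁ m≤1 = inj₁ (mark≤1⇒1-marked {zs} p m≤1)
... | inj₂ q   = q

odd-1-marked-or-2-taken : ∀ {zs n m} → AllPairs _≤_ zs → oddᵇ (suc n) ≡ true
                        → (suc n , m) ∈ markGo [] zs
                        → (suc n , 1) ∈ markGo [] zs
                          ⊎ (suc n , 2) ∈ markGo [] zs ⊎ (n , 2) ∈ markGo [] zs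
odd-1-marked-or-2-taken {zs} asc odd p with odd-mark≤-or-taken asc odd p (s≤s z≤n)
... | inj₂ q   = inj₂ q
... | inj₁ m≤2 with between-suc (mark-positive {zs} p) m≤2
...   | inj₁ refl = inj₁ p
...   | inj₂ refl = inj₂ (inj₁ p)

module _ {zs : List ℕ} (asc : AllPairs _≤_ zs)
         {n : ℕ} (odd : oddᵇ (suc n) ≡ true) (o∈zs : suc n ∈ zs) where

  private
    odd+1-even : oddᵇ (2 + n) ≡ false
    odd+1-even = odd⇒suc-even (suc n) odd

    taken-by-odd-or-pred : ∀ {j S} → (suc n , j) ∈ S ⊎ (n , j) ∈ S → j ∈ conflictingMarks (2 + n) S
    taken-by-odd-or-pred (inj₁ q) =
      conflictingMarks⁺ q (even-conflict (2 + n) (suc n) odd+1-even (s≤s (s≤s (n≤1+n n))))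
    taken-by-odd-or-pred (inj₂ q) =
      conflictingMarks⁺ q (even-conflict (2 + n) n odd+1-even ≤-refl)

    odd-marked-before : ∀ {m} (E : Entry [] zs (2 + n) m) → ∃[ m′ ] (suc n , m′) ∈ markGo [] (before E)
    odd-marked-before E = markGo-total [] _ (smaller-before asc E o∈zs ≤-refl)

  odd+1-not-1-marked : ∀ {m} → (2 + n , m) ∈ markGo [] zs → m ≢ 1
  odd+1-not-1-marked p with E ← entry {zs} p with m′ , q ← odd-marked-before E =
    subst (_≢ 1) (sym (mark≡ E))
      (mex-≢ _ (taken-by-odd-or-pred (odd-or-pred-1-marked (before-ascending asc E) odd q)) (s≤s z≤n))

  odd+1-2-marked⇒odd-1-marked : (2 + n , 2) ∈ markGo [] zs → (suc n , 1) ∈ markGo [] zs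
  odd+1-2-marked⇒odd-1-marked p with E ← entry {zs} p with m′ , q ← odd-marked-before E
    with odd-1-marked-or-2-taken (before-ascending asc E) odd q
  ... | inj₁ q₁ = entry-⊆ E q₁
  ... | inj₂ q₂ = ⊥-elim (mex-≢ _ (taken-by-odd-or-pred q₂) ≤-refl (sym (mark≡ E)))

  odd+3-marked⇒1-marked : 3 + n ∉ zs → ∀ {m} → (4 + n , m) ∈ markGo [] zs → (4 + n , 1) ∈ markGo [] zs
  odd+3-marked⇒1-marked 3+n∉zs p with mark≤-or-taken asc p ≤-refl
  ... | inj₁ m≤1 = mark≤1⇒1-marked {zs} p m≤1
  ... | inj₂ (y , q , y≤4+n , c) with y ≟ 4 + n
  ...   | yes refl = q
  ...   | no y≢4+n with between-suc (s≤s⁻¹ (s≤s⁻¹ (conflict⇒≤2+ _ y c))) (s≤s⁻¹ (≤∧≢⇒< y≤4+n y≢4+n))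
  ...     | inj₁ refl = ⊥-elim (odd+1-not-1-marked q refl)
  ...     | inj₂ refl = ⊥-elim (3+n∉zs (markGo-parts q))

part-∈ : ∀ xs {b} → 1 ≤ b → b ≤ length xs → part xs b ∈ xs
part-∈ (x ∷ xs) {suc zero}    _ _         = here refl
part-∈ (x ∷ xs) {suc (suc b)} _ (s≤s b≤n) = there (part-∈ xs (s≤s z≤n) b≤n)

p2-2-marked : ∀ π {b} → 1 ≤ b → b ≤ N π 2 → Marked π 2 (p2 π b)
p2-2-marked π 1≤b b≤N with ∈-map⁻ proj₁ (reverse⁻ (part-∈ (markedParts π 2) 1≤b b≤N))
... | (x , j) , p , refl with ∈-filter⁻ (T? ∘ λ p → proj₂ p ≡ᵇ 2) p
...   | q , j≡ᵇ2 = subst (λ i → (x , i) ∈ GG π) (≡ᵇ⇒≡ j 2 j≡ᵇ2) q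

no-odd-above : ∀ {o v} π → All (λ x → Odd x → x ≤ o) π → o < v
             → T (all (λ q → not (oddᵇ q) ∨ (q <ᵇ v)) π)
no-odd-above {o} {v} π odd≤o o<v = all⁻ _ (All.map below odd≤o)
  where
  below : ∀ {q} → (Odd q → q ≤ o) → T (not (oddᵇ q) ∨ (q <ᵇ v))
  below {q} h with oddᵇ q in odd
  ... | false = tt
  ... | true  = <⇒<ᵇ (≤-<-trans (h (≡ᵇ⇒≡ _ 1 (subst T (sym odd) tt))) o<v)

largestFrom-≥ : ∀ π m {l} → T (noOddAboveᵇ π l) → l ≤ m → l ≤ largestFrom π m
largestFrom-≥ π zero    _ l≤0 = l≤0
largestFrom-≥ π (suc m) h l≤m with noOddAboveᵇ π (suc m) in ok
... | true  = l≤m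
... | false with m≤n⇒m<n∨m≡n l≤m
...   | inj₁ l<1+m = largestFrom-≥ π m h (s≤s⁻¹ l<1+m)
...   | inj₂ refl  = ⊥-elim (subst T ok h)

odd-below-p2⇒InRange : ∀ π {o b} → All (λ x → Odd x → x ≤ o) π → 1 ≤ b → b ≤ N π 2 → o < p2 π b
                     → InRange π b
odd-below-p2⇒InRange π {b = suc b} odd≤o 1≤b b≤N o<p =
  1≤b , largestFrom-≥ π (N π 2) (no-odd-above π odd≤o o<p) b≤N

Marked? : ∀ π j x → Dec (Marked π j x)
Marked? π j x = DecMembership._∈?_ (≡-dec _≟_ _≟_) (x , j) (GG π)

Occurs? : ∀ π x → Dec (Occurs π x)
Occurs? π x = DecMembership._∈?_ _≟_ x π

InRange? : ∀ π b → Dec (InRange π b)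
InRange? π b = (1 ≤? b) ×-dec (b ≤? lval π)

mutual
  TypeS0? : ∀ π b → Dec (TypeS0 π b)
  TypeS0? π zero          = no λ ()
  TypeS0? π (suc zero)    = InRange? π 1 ×-dec (Marked? π 1 _ ×-dec ¬? (Occurs? π _))
  TypeS0? π (suc (suc b)) =
    InRange? π _ ×-dec (Marked? π 1 _ ×-dec (Marked? π 1 _ →-dec SVal? π (suc b) _))

  TypeS1? : ∀ π b → Dec (TypeS1 π b)
  TypeS1? π zero          = no λ ()
  TypeS1? π (suc zero)    = InRange? π 1 ×-dec (Marked? π 1 _ ×-dec ¬? (Occurs? π _))
  TypeS1? π (suc (suc b)) =
    InRange? π _ ×-dec (Marked? π 1 _ ×-dec (Marked? π 1 _ →-dec SVal? π (suc b) _))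

  TypeS2? : ∀ π b → Dec (TypeS2 π b)
  TypeS2? π zero          = no λ ()
  TypeS2? π (suc zero)    = InRange? π 1 ×-dec Marked? π 1 _
  TypeS2? π (suc (suc b)) = InRange? π _ ×-dec (Marked? π 1 _ ×-dec ¬? (SVal? π (suc b) _))

  TypeS3? : ∀ π b → Dec (TypeS3 π b)
  TypeS3? π zero    = no λ ()
  TypeS3? π (suc b) = InRange? π _ ×-dec Marked? π 1 _

  SVal? : ∀ π b v → Dec (SVal π b v)
  SVal? π b v = (TypeS0? π b ×-dec (v ≟ _)) ⊎-dec (TypeS1? π b ×-dec (v ≟ _))
    ⊎-dec (TypeS2? π b ×-dec (v ≟ _)) ⊎-dec (TypeS3? π b ×-dec (v ≟ _))

s0-or-s2 : ∀ π b → InRange π b → Marked π 1 (p2 π b ∸ 1)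
         → (Occurs π (p2 π b + 2) → Marked π 1 (p2 π b + 2))
         → TypeS0 π b ⊎ TypeS2 π b
s0-or-s2 π (suc zero) ir m₁ occurs⇒marked with Occurs? π (p2 π 1 + 2)
... | yes occ = inj₂ (ir , occurs⇒marked occ)
... | no ¬occ = inj₁ (ir , m₁ , ¬occ)
s0-or-s2 π (suc (suc b)) ir m₁ _ with Marked? π 1 (p2 π (2 + b) + 2)
... | no ¬m₂ = inj₁ (ir , m₁ , λ m₂ → ⊥-elim (¬m₂ m₂))
... | yes m₂ with SVal? π (suc b) (p2 π (2 + b) + 2)
...   | yes s = inj₁ (ir , m₁ , λ _ → s)
...   | no ¬s = inj₂ (ir , m₂ , ¬s)

starting-types-above-largest-odd :
  ∀ π n → Linked (λ a b → b ≤ a) π → LargestOdd π (suc n)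
  → ((b : ℕ) → 1 ≤ b → b ≤ N π 2 → p2 π b ≡ 2 + n → TypeS0 π b ⊎ TypeS2 π b)
  × ((b : ℕ) → 1 ≤ b → b ≤ N π 2 → p2 π b ≡ 4 + n → TypeS3 π b)
starting-types-above-largest-odd π n linked (o∈π , o-odd , odd≤o) = s0-or-s2-at-2+n , s3-at-4+n
  where
  asc : AllPairs _≤_ (reverse π)
  asc = AllPairs-reverse (Linked⇒AllPairs (λ b≤a c≤b → ≤-trans c≤b b≤a) linked)

  odd : oddᵇ (suc n) ≡ true
  odd = cong (_≡ᵇ 1) o-odd

  3+n-absent : 3 + n ∉ reverse π
  3+n-absent 3+n∈ = 1+n≰n (≤-trans (n≤1+n _) (All.lookup odd≤o (reverse⁻ 3+n∈) o-odd))

  4+n-1-marked : ∀ {m} → Marked π m (4 + n) → Marked π 1 (4 + n)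
  4+n-1-marked = odd+3-marked⇒1-marked asc odd (reverse⁺ o∈π) 3+n-absent

  s0-or-s2-at-2+n : (b : ℕ) → 1 ≤ b → b ≤ N π 2 → p2 π b ≡ 2 + n → TypeS0 π b ⊎ TypeS2 π b
  s0-or-s2-at-2+n b 1≤b b≤N p≡ = s0-or-s2 π b
    (odd-below-p2⇒InRange π odd≤o 1≤b b≤N (subst (suc n <_) (sym p≡) ≤-refl))
    (subst (λ v → Marked π 1 (v ∸ 1)) (sym p≡)
      (odd+1-2-marked⇒odd-1-marked asc odd (reverse⁺ o∈π)
        (subst (Marked π 2) p≡ (p2-2-marked π 1≤b b≤N))))
    (λ occ → subst (Marked π 1) (sym p+2≡)
      (4+n-1-marked (proj₂ (markGo-total [] (reverse π) (reverse⁺ (subst (Occurs π) p+2≡ occ))))))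
    where
    p+2≡ : p2 π b + 2 ≡ 4 + n
    p+2≡ = trans (cong (_+ 2) p≡) (+-comm (2 + n) 2)

  s3-at-4+n : (b : ℕ) → 1 ≤ b → b ≤ N π 2 → p2 π b ≡ 4 + n → TypeS3 π b
  s3-at-4+n (suc b) 1≤b b≤N p≡ =
    odd-below-p2⇒InRange π odd≤o 1≤b b≤N (subst (suc n <_) (sym p≡) (m≤n+m (2 + n) 2)) ,
    subst (Marked π 1) (sym p≡) (4+n-1-marked (subst (Marked π 2) p≡ (p2-2-marked π 1≤b b≤N)))

corollary2p11 : (k r t : ℕ) → 3 ≤ r → r ≤ k → (π : List ℕ) → InC k r π
    → LargestOdd π (2 * t + 1)
    → ((b : ℕ) → 1 ≤ b → b ≤ N π 2 → p2 π b ≡ 2 * t + 2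
         → TypeS0 π b ⊎ TypeS2 π b)
    × ((b : ℕ) → 1 ≤ b → b ≤ N π 2 → p2 π b ≡ 2 * t + 4
         → TypeS3 π b)
corollary2p11 k r t _ _ π ((_ , linked) , _)
  rewrite +-comm (2 * t) 1 | +-comm (2 * t) 2 | +-comm (2 * t) 4 =
  starting-types-above-largest-odd π (2 * t) linked
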